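{- Let $N$ be a finite set, $f:2^N\to\mathbb{R}_+$ non-negative, symmetric and submodular, $k\in\mathbb{N}_+$, and $O\in\arg\max\{f(S):S\subseteq N,|S|\le k\}$. Run the algorithm \textsc{Greedy-Cardinality}: $S_0=\emptyset$; for $i=1,\dots,k$, choose $u_i\in\arg\max_{u\in N}f(u\mid S_{i-1})$, set $S_i\gets S_{i-1}+u_i$ and then $S_i\gets\textsc{Delete}(S_i)$. Then for every $i\in[k]$, $f(S_i)-f(S_{i-1})\ge\frac1k\,(f(O)-2f(S_{i-1}))$.
   Context: $f$ is symmetric if $f(S)=f(N\setminus S)$ for all $S\subseteq N$; submodular if $f(S)+f(T)\ge f(S\cup T)+f(S\cap T)$ for all $S,T$. $S+u=S\cup\{u\}$, $S-u=S\setminus\{u\}$, $f(u\mid S)=f(S+u)-f(S)$. The procedure \textsc{Delete}$(S)$ visits the elements $u$ of the input set $S$ one by one in arbitrary order, and for each visited $u$, if $f(u\mid S-u)<0$ for the current set $S$, it sets $S\gets S-u$; it returns the final set $S$.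
   Formalization: The function f takes non-negative rational values rather than values in $\mathbb{R}_+$. -}

module Defs where

open import Data.Nat using (ℕ; suc; _<_) renaming (_≤_ to _≤ℕ_)
open import Data.Fin using (Fin)
open import Data.Fin.Subset using (Subset; ∁; _∪_; _∩_; _-_; ⁅_⁆; ∣_∣; ⊥) renaming (_∈_ to _∈ₛ_)
open import Data.Rational using (ℚ; 0ℚ; _+_; _≤_; _<?_) renaming (_-_ to _-ℚ_)
open import Data.List using (List; []; _∷_)
open import Data.List.Membership.Propositional using () renaming (_∈_ to _∈ₗ_)
open import Data.List.Relation.Unary.Unique.Propositional using (Unique)
open import Data.Product using (Σ; _×_)
open import Data.Bool using (if_then_else_)
open import Relation.Nullary.Decidable using (⌊_⌋)
open import Relation.Binary.PropositionalEquality using (_≡_)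

_+ₑ_ : ∀ {n} → Subset n → Fin n → Subset n
S +ₑ u = S ∪ ⁅ u ⁆

_-ₑ_ : ∀ {n} → Subset n → Fin n → Subset n
S -ₑ u = S - u

marg : ∀ {n} → (Subset n → ℚ) → Fin n → Subset n → ℚ
marg f u S = f (S +ₑ u) -ℚ f S

NonNegative : ∀ {n} → (Subset n → ℚ) → Set
NonNegative f = ∀ S → 0ℚ ≤ f S

Symmetric : ∀ {n} → (Subset n → ℚ) → Set
Symmetric f = ∀ S → f S ≡ f (∁ S)

Submodular : ∀ {n} → (Subset n → ℚ) → Set
Submodular f = ∀ S T → f (S ∪ T) + f (S ∩ T) ≤ f S + f T

IsOptimal : ∀ {n} → (Subset n → ℚ) → ℕ → Subset n → Set
IsOptimal f k O = (∣ O ∣ ≤ℕ k) × (∀ S → ∣ S ∣ ≤ℕ k → f S ≤ f O)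

-- Delete, with the visiting order given explicitly as a list:
-- visit u; if f(u | S - u) < 0 for the current S then S ← S - u.
deleteWith : ∀ {n} → (Subset n → ℚ) → List (Fin n) → Subset n → Subset n
deleteWith f [] S = S
deleteWith f (u ∷ us) S =
  deleteWith f us (if ⌊ marg f u (S -ₑ u) <? 0ℚ ⌋ then S -ₑ u else S)

IsDeleteOutput : ∀ {n} → (Subset n → ℚ) → Subset n → Subset n → Set
IsDeleteOutput {n} f S S' =
  Σ (List (Fin n)) λ order →
    Unique order × (∀ u → (u ∈ₗ order → u ∈ₛ S) × (u ∈ₛ S → u ∈ₗ order))
    × (S' ≡ deleteWith f order S)

IsArgmaxMarg : ∀ {n} → (Subset n → ℚ) → Subset n → Fin n → Set
IsArgmaxMarg f S u = ∀ v → marg f v S ≤ marg f u S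

-- A possible execution of Greedy-Cardinality with k iterations:
-- Ss i = S_i for i = 0..k (values beyond k are irrelevant).
IsGreedyRun : ∀ {n} → (Subset n → ℚ) → ℕ → (ℕ → Subset n) → Set
IsGreedyRun {n} f k Ss =
  (Ss 0 ≡ ⊥) ×
  (∀ i → i < k → Σ (Fin n) λ u →
     IsArgmaxMarg f (Ss i) u × IsDeleteOutput f (Ss i +ₑ u) (Ss (suc i)))

{-# OPTIONS --safe #-}
module Submission where

-- Let S = S_{i-1}, let u be the greedy element and δ = f(u ∣ S) ≥ 0.
-- Delete leaves a set from which no single deletion increases f, and by
-- submodularity such a set dominates all its subsets: f(S ─ O) ≤ f(S).
-- Adding the at most k elements of O to S one at a time gains at most δ
-- each time (diminishing returns), so f(S ∪ O) ≤ f(S) + kδ.  Submodularity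
-- on S ∪ O and ∁(S ─ O), whose intersection is O, together with symmetry
-- and non-negativity gives f(O) ≤ f(S ∪ O) + f(S ─ O) ≤ 2f(S) + kδ, while
-- f(S_i) ≥ f(S + u) = f(S) + δ because Delete never decreases f.

open import Defs
open import Data.Nat using (ℕ; suc; NonZero; _∸_) renaming (_≤_ to _≤ℕ_)
open import Data.Integer using (+_)
open import Data.Fin.Subset using (Subset)
open import Data.Rational using (ℚ; _+_; _-_; _*_; _/_; _≤_)

import Data.Nat as ℕ
import Data.Nat.Properties as ℕ
import Data.Integer as ℤ
import Data.Integer.Properties as ℤ
open import Data.Nat.Coprimality using (1-coprimeTo) renaming (sym to coprime-sym)
open import Data.Rational using (mkℚ; 0ℚ; 1ℚ; -_; _<_; _<?_)
import Data.Rational as ℚ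
open import Data.Rational.Properties
  using ( module ≤-Reasoning; ≤-refl; ≤-reflexive; ≤-trans; <⇒≤; ≮⇒≥; <-irrefl; <-≤-trans
        ; +-comm; +-assoc; +-identityʳ; +-inverseʳ; +-mono-≤; +-monoˡ-≤; +-monoʳ-≤; +-mono-<
        ; *-assoc; *-identityʳ; *-zeroˡ; *-inverseʳ; *-monoʳ-≤-nonNeg; pos⇒nonNeg
        ; normalize-coprime; normalize-pos; toℚᵘ-injective; toℚᵘ-homo-+ )
import Data.Rational.Unnormalised as ℚᵘ
import Data.Rational.Unnormalised.Properties as ℚᵘ
open import Data.Rational.Solver using (module +-*-Solver)
open import Data.Fin using (Fin; _≟_)
open import Data.Fin.Subset
  using (_∪_; _∩_; ∁; ⁅_⁆; _─_; ⊤; ⊥; _⊆_; _⊂_; Empty; ∣_∣; inside; outside; _∈_; _∉_)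
open import Data.Fin.Subset.Properties
  using ( _∈?_; nonempty?; Empty-unique; ∉⊥; x∈⁅x⁆; x∈⁅y⁆⇒x≡y; ⊆-antisym
        ; x∈p∪q⁻; q⊆p∪q; p⊆p∪q; x∈p∩q⁺; x∈p∩q⁻; p∩q⊆p
        ; p─q⊆p; x∈p∧x∉q⇒x∈p─q; x∈p∧x≢y⇒x∈p-y; x∈p⇒p-x⊂p; x∈p⇒∣p-x∣<∣p∣
        ; ∪-assoc; ∪-comm; ∪-identityʳ; ∩-identityˡ; ∩-inverseʳ; ∩-distribʳ-∪; p∪∁p≡⊤ )
open import Data.Fin.Subset.Induction using (⊂-wellFounded)
open import Data.Vec using (_∷_; []; here; there)
open import Data.List using ([]; _∷_)
open import Data.List.Membership.Propositional using () renaming (_∈_ to _∈ₗ_)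
open import Data.List.Relation.Unary.Any using (here; there)
open import Data.Product using (_,_; proj₂)
open import Data.Sum using ([_,_]′)
open import Function using (id; _∘_)
open import Induction.WellFounded using (Acc; acc)
open import Relation.Nullary using (yes; no; contradiction)
open import Relation.Binary.PropositionalEquality
  using (_≡_; refl; sym; trans; cong; cong₂; subst; subst₂; module ≡-Reasoning)

private
  variable
    n : ℕ
    p q r s : ℚ
    x : Fin n
    A B S T : Subset n

module _ where
  open +-*-Solver
  open ≤-Reasoning

  p-q≤r⇒p≤q+r : p - q ≤ r → p ≤ q + r
  p-q≤r⇒p≤q+r {p} {q} {r} h = begin
    p            ≡⟨ solve 2 (λ p q → p := q :+ (p :- q)) refl p q ⟩
    q + (p - q)  ≤⟨ +-monoʳ-≤ q h ⟩
    q + r        ∎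

  p≤q+r⇒p-q≤r : p ≤ q + r → p - q ≤ r
  p≤q+r⇒p-q≤r {p} {q} {r} h = begin
    p - q        ≤⟨ +-monoˡ-≤ (- q) h ⟩
    q + r - q    ≡⟨ solve 2 (λ q r → q :+ r :- q := r) refl q r ⟩
    r            ∎

  p+q≤r+s⇒p-s≤r-q : p + q ≤ r + s → p - s ≤ r - q
  p+q≤r+s⇒p-s≤r-q {p} {q} {r} {s} h = begin
    p - s                ≡⟨ solve 3 (λ p q s → p :- s := (p :+ q) :- (q :+ s)) refl p q s ⟩
    (p + q) - (q + s)    ≤⟨ +-monoˡ-≤ (- (q + s)) h ⟩
    (r + s) - (q + s)    ≡⟨ solve 3 (λ r q s → (r :+ s) :- (q :+ s) := r :- q) refl r q s ⟩
    r - q                ∎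

  p≤q⇒0≤q-p : p ≤ q → 0ℚ ≤ q - p
  p≤q⇒0≤q-p {p} {q} h = begin
    0ℚ     ≡⟨ sym (+-inverseʳ p) ⟩
    p - p  ≤⟨ +-monoˡ-≤ (- p) h ⟩
    q - p  ∎

  p≤p+q : 0ℚ ≤ q → p ≤ p + q
  p≤p+q {q} {p} h = begin
    p       ≡⟨ sym (+-identityʳ p) ⟩
    p + 0ℚ  ≤⟨ +-monoʳ-≤ p h ⟩
    p + q   ∎

  0≤p-q⇒q≤p : 0ℚ ≤ p - q → q ≤ p
  0≤p-q⇒q≤p {p} {q} h = begin
    q            ≤⟨ p≤p+q h ⟩
    q + (p - q)  ≡⟨ solve 2 (λ p q → q :+ (p :- q) := p) refl p q ⟩
    p            ∎

  p≤q+p : 0ℚ ≤ q → p ≤ q + p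
  p≤q+p {q} {p} h = subst (p ≤_) (+-comm p q) (p≤p+q h)

  p-q<0⇒p≤q : p - q < 0ℚ → p ≤ q
  p-q<0⇒p≤q {p} {q} h = subst (p ≤_) (+-identityʳ q) (p-q≤r⇒p≤q+r (<⇒≤ h))

  p+p≤q+q⇒p≤q : p + p ≤ q + q → p ≤ q
  p+p≤q+q⇒p≤q h = ≮⇒≥ (λ q<p → <-irrefl refl (<-≤-trans (+-mono-< q<p q<p) h))

fromℕ : ℕ → ℚ
fromℕ j = mkℚ (+ j) 0 (coprime-sym (1-coprimeTo j))

fromℕ-suc : ∀ j → fromℕ (suc j) ≡ 1ℚ + fromℕ j
fromℕ-suc j = toℚᵘ-injective (ℚᵘ.≃-sym (ℚᵘ.≃-trans (toℚᵘ-homo-+ 1ℚ (fromℕ j)) (ℚᵘ.*≡* cross)))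
  where
  cross : (+ 1 ℤ.* + 1 ℤ.+ + j ℤ.* + 1) ℤ.* + 1 ≡ + suc j ℤ.* (+ 1 ℤ.* + 1)
  cross = trans (ℤ.*-identityʳ _)
                (trans (cong (ℤ._+_ (+ 1)) (ℤ.*-identityʳ (+ j))) (sym (ℤ.*-identityʳ (+ suc j))))

*-fromℕ-suc : ∀ p j → p * fromℕ (suc j) ≡ p * fromℕ j + p
*-fromℕ-suc p j = trans (cong (p *_) (fromℕ-suc j))
  (solve 2 (λ p m → p :* (con 1ℚ :+ m) := p :* m :+ p) refl p (fromℕ j))
  where open +-*-Solver

-- Once normalize-coprime has brought + 1 / suc k into the form mkℚ (+ 1) k _,
-- it is literally 1/ (fromℕ (suc k)).
fromℕ-*-1/ : ∀ k .{{_ : NonZero k}} → fromℕ k * (+ 1 / k) ≡ 1ℚ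
fromℕ-*-1/ (suc k) rewrite normalize-coprime {1} {k} (1-coprimeTo (suc k)) = *-inverseʳ (fromℕ (suc k))

p≤q*k⇒p*[1/k]≤q : ∀ k .{{_ : NonZero k}} → p ≤ q * fromℕ k → p * (+ 1 / k) ≤ q
p≤q*k⇒p*[1/k]≤q {p} {q} k@(suc _) h = begin
  p * (+ 1 / k)                ≤⟨ *-monoʳ-≤-nonNeg (+ 1 / k) {{1/k≥0}} h ⟩
  q * fromℕ k * (+ 1 / k)      ≡⟨ *-assoc q (fromℕ k) (+ 1 / k) ⟩
  q * (fromℕ k * (+ 1 / k))    ≡⟨ cong (q *_) (fromℕ-*-1/ k) ⟩
  q * 1ℚ                       ≡⟨ *-identityʳ q ⟩
  q                            ∎
  where
  open ≤-Reasoning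
  1/k≥0 : ℚ.NonNegative (+ 1 / k)
  1/k≥0 = pos⇒nonNeg (+ 1 / k) {{normalize-pos 1 k}}

x∈p─q⇒x∉q : ∀ (p q : Subset n) → x ∈ p ─ q → x ∉ q
x∈p─q⇒x∉q (_ ∷ p) (_ ∷ q)      (there x∈p─q) (there x∈q) = x∈p─q⇒x∉q p q x∈p─q x∈q
x∈p─q⇒x∉q (_ ∷ p) (inside ∷ q) ()            here

x∉p-x : x ∉ A -ₑ x
x∉p-x {x = x} {A = A} x∈A-x = x∈p─q⇒x∉q A ⁅ x ⁆ x∈A-x (x∈⁅x⁆ x)

p⊆q⇒p-x⊆q-x : A ⊆ B → A -ₑ x ⊆ B -ₑ x
p⊆q⇒p-x⊆q-x {A = A} {x = x} A⊆B y∈A-x =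
  x∈p∧x∉q⇒x∈p─q (A⊆B (p─q⊆p A ⁅ x ⁆ y∈A-x)) (x∈p─q⇒x∉q A ⁅ x ⁆ y∈A-x)

x∈p⇒⁅x⁆⊆p : x ∈ A → ⁅ x ⁆ ⊆ A
x∈p⇒⁅x⁆⊆p {x = x} {A = A} x∈A y∈⁅x⁆ = subst (_∈ A) (sym (x∈⁅y⁆⇒x≡y x y∈⁅x⁆)) x∈A

p⊆q⇒p∪q≡q : A ⊆ B → A ∪ B ≡ B
p⊆q⇒p∪q≡q {A = A} {B = B} A⊆B = ⊆-antisym ([ A⊆B , id ]′ ∘ x∈p∪q⁻ A B) (q⊆p∪q A B)

p⊆q⇒p∩q≡p : A ⊆ B → A ∩ B ≡ A
p⊆q⇒p∩q≡p {A = A} {B = B} A⊆B = ⊆-antisym (p∩q⊆p A B) (λ x∈A → x∈p∩q⁺ (x∈A , A⊆B x∈A))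

x∉p⇒⁅x⁆∩p≡⊥ : x ∉ A → ⁅ x ⁆ ∩ A ≡ ⊥
x∉p⇒⁅x⁆∩p≡⊥ {x = x} {A = A} x∉A = Empty-unique λ (y , y∈⁅x⁆∩A) →
  let y∈⁅x⁆ , y∈A = x∈p∩q⁻ ⁅ x ⁆ A y∈⁅x⁆∩A in
  x∉A (subst (_∈ A) (x∈⁅y⁆⇒x≡y x y∈⁅x⁆) y∈A)

x∈p⇒p+x≡p : x ∈ A → A +ₑ x ≡ A
x∈p⇒p+x≡p {A = A} x∈A = trans (∪-comm A _) (p⊆q⇒p∪q≡q (x∈p⇒⁅x⁆⊆p x∈A))

x∈p⇒p-x+x≡p : x ∈ A → (A -ₑ x) +ₑ x ≡ A
x∈p⇒p-x+x≡p {x = x} {A = A} x∈A = ⊆-antisym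
  ([ p─q⊆p A ⁅ x ⁆ , x∈p⇒⁅x⁆⊆p x∈A ]′ ∘ x∈p∪q⁻ (A -ₑ x) ⁅ x ⁆)
  A⊆A-x+x
  where
  A⊆A-x+x : A ⊆ (A -ₑ x) +ₑ x
  A⊆A-x+x {y} y∈A with y ≟ x
  ... | yes refl = q⊆p∪q (A -ₑ x) ⁅ x ⁆ (x∈⁅x⁆ x)
  ... | no  y≢x  = p⊆p∪q ⁅ x ⁆ (x∈p∧x≢y⇒x∈p-y y∈A y≢x)

x∉p⇒p-x≡p : x ∉ A → A -ₑ x ≡ A
x∉p⇒p-x≡p {A = A} x∉A = ⊆-antisym (p─q⊆p A _) (λ y∈A → x∈p∧x≢y⇒x∈p-y y∈A λ { refl → x∉A y∈A })

p⊆q⇒[p+x]∪q≡q+x : A ⊆ B → (A +ₑ x) ∪ B ≡ B +ₑ x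
p⊆q⇒[p+x]∪q≡q+x {A = A} {B = B} {x = x} A⊆B = begin
  (A ∪ ⁅ x ⁆) ∪ B    ≡⟨ ∪-assoc A ⁅ x ⁆ B ⟩
  A ∪ (⁅ x ⁆ ∪ B)    ≡⟨ cong (A ∪_) (∪-comm ⁅ x ⁆ B) ⟩
  A ∪ (B ∪ ⁅ x ⁆)    ≡⟨ sym (∪-assoc A B ⁅ x ⁆) ⟩
  (A ∪ B) ∪ ⁅ x ⁆    ≡⟨ cong (_∪ ⁅ x ⁆) (p⊆q⇒p∪q≡q A⊆B) ⟩
  B ∪ ⁅ x ⁆          ∎
  where open ≡-Reasoning

p⊆q∧x∉q⇒[p+x]∩q≡p : A ⊆ B → x ∉ B → (A +ₑ x) ∩ B ≡ A
p⊆q∧x∉q⇒[p+x]∩q≡p {A = A} {B = B} {x = x} A⊆B x∉B = begin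
  (A ∪ ⁅ x ⁆) ∩ B          ≡⟨ ∩-distribʳ-∪ B A ⁅ x ⁆ ⟩
  (A ∩ B) ∪ (⁅ x ⁆ ∩ B)    ≡⟨ cong₂ _∪_ (p⊆q⇒p∩q≡p A⊆B) (x∉p⇒⁅x⁆∩p≡⊥ x∉B) ⟩
  A ∪ ⊥                    ≡⟨ ∪-identityʳ A ⟩
  A                        ∎
  where open ≡-Reasoning

[p∪q]∩∁[p─q]≡q : ∀ (A B : Subset n) → (A ∪ B) ∩ ∁ (A ─ B) ≡ B
[p∪q]∩∁[p─q]≡q []            []            = refl
[p∪q]∩∁[p─q]≡q (inside  ∷ A) (inside  ∷ B) = cong (inside ∷_)  ([p∪q]∩∁[p─q]≡q A B)
[p∪q]∩∁[p─q]≡q (outside ∷ A) (inside  ∷ B) = cong (inside ∷_)  ([p∪q]∩∁[p─q]≡q A B)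
[p∪q]∩∁[p─q]≡q (inside  ∷ A) (outside ∷ B) = cong (outside ∷_) ([p∪q]∩∁[p─q]≡q A B)
[p∪q]∩∁[p─q]≡q (outside ∷ A) (outside ∷ B) = cong (outside ∷_) ([p∪q]∩∁[p─q]≡q A B)

∁⊤≡⊥ : ∁ (⊤ {n}) ≡ ⊥
∁⊤≡⊥ = trans (sym (∩-identityˡ (∁ ⊤))) (∩-inverseʳ ⊤)

Empty[p─q]⇒p⊆q : Empty (A ─ B) → A ⊆ B
Empty[p─q]⇒p⊆q {B = B} A─B-empty {x} x∈A with x ∈? B
... | yes x∈B = x∈B
... | no  x∉B = contradiction (x , x∈p∧x∉q⇒x∈p─q x∈A x∉B) A─B-empty

LocallyOptimal : (Subset n → ℚ) → Subset n → Set
LocallyOptimal f S = ∀ {w} → w ∈ S → 0ℚ ≤ marg f w (S -ₑ w)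

module _ (f : Subset n → ℚ) where

  marg-∈ : x ∈ S → marg f x S ≡ 0ℚ
  marg-∈ {S = S} x∈S = trans (cong (λ X → f X - f S) (x∈p⇒p+x≡p x∈S)) (+-inverseʳ (f S))

  LocallyOptimal⇒f[p-x]≤f[p] : LocallyOptimal f S → x ∈ S → f (S -ₑ x) ≤ f S
  LocallyOptimal⇒f[p-x]≤f[p] {S = S} {x = x} opt x∈S =
    0≤p-q⇒q≤p (subst (λ X → 0ℚ ≤ f X - f (S -ₑ x)) (x∈p⇒p-x+x≡p x∈S) (opt x∈S))

  f[p]≤f[p-x] : marg f x (S -ₑ x) < 0ℚ → f S ≤ f (S -ₑ x)
  f[p]≤f[p-x] {x = x} {S = S} loss with x ∈? S
  ... | yes x∈S = subst (λ X → f X ≤ f (S -ₑ x)) (x∈p⇒p-x+x≡p x∈S) (p-q<0⇒p≤q loss)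
  ... | no  x∉S = ≤-reflexive (cong f (sym (x∉p⇒p-x≡p x∉S)))

  f≤f-deleteWith : ∀ order S → f S ≤ f (deleteWith f order S)
  f≤f-deleteWith []       S = ≤-refl
  f≤f-deleteWith (u ∷ us) S with marg f u (S -ₑ u) <? 0ℚ
  ... | yes loss = ≤-trans (f[p]≤f[p-x] loss) (f≤f-deleteWith us (S -ₑ u))
  ... | no  _    = f≤f-deleteWith us S

  deleteWith-⊆ : ∀ order S → deleteWith f order S ⊆ S
  deleteWith-⊆ []       S = id
  deleteWith-⊆ (u ∷ us) S with marg f u (S -ₑ u) <? 0ℚ
  ... | yes _ = p─q⊆p S ⁅ u ⁆ ∘ deleteWith-⊆ us (S -ₑ u)
  ... | no  _ = deleteWith-⊆ us S

  f≤f-IsDeleteOutput : IsDeleteOutput f S T → f S ≤ f T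
  f≤f-IsDeleteOutput {S = S} (order , _ , _ , refl) = f≤f-deleteWith order S

  module _ (submodular : Submodular f) where

    marg-antitone : A ⊆ B → x ∉ B → marg f x B ≤ marg f x A
    marg-antitone {A = A} {B = B} {x = x} A⊆B x∉B = p+q≤r+s⇒p-s≤r-q {f (B +ₑ x)} {f A} {f (A +ₑ x)} {f B}
      (subst₂ (λ X Y → f X + f Y ≤ f (A +ₑ x) + f B)
              (p⊆q⇒[p+x]∪q≡q+x A⊆B) (p⊆q∧x∉q⇒[p+x]∩q≡p A⊆B x∉B)
              (submodular (A +ₑ x) B))

    0≤marg-⊆ : A ⊆ B → 0ℚ ≤ marg f x (B -ₑ x) → 0ℚ ≤ marg f x (A -ₑ x)
    0≤marg-⊆ A⊆B gain = ≤-trans gain (marg-antitone (p⊆q⇒p-x⊆q-x A⊆B) x∉p-x)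

    LocallyOptimal-⊆ : A ⊆ B → LocallyOptimal f B → LocallyOptimal f A
    LocallyOptimal-⊆ A⊆B opt w∈A = 0≤marg-⊆ A⊆B (opt (A⊆B w∈A))

    deleteWith-locallyOptimal : ∀ order S {w} → w ∈ₗ order → w ∈ deleteWith f order S →
                                0ℚ ≤ marg f w (deleteWith f order S -ₑ w)
    deleteWith-locallyOptimal []       S ()
    deleteWith-locallyOptimal (u ∷ us) S w∈u∷us w∈D with marg f u (S -ₑ u) <? 0ℚ | w∈u∷us
    ... | yes _     | here refl = contradiction (deleteWith-⊆ us (S -ₑ u) w∈D) x∉p-x
    ... | yes _     | there w∈us = deleteWith-locallyOptimal us (S -ₑ u) w∈us w∈D
    ... | no  ¬loss | here refl = 0≤marg-⊆ (deleteWith-⊆ us S) (≮⇒≥ ¬loss)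
    ... | no  _     | there w∈us = deleteWith-locallyOptimal us S w∈us w∈D

    IsDeleteOutput⇒LocallyOptimal : IsDeleteOutput f S T → LocallyOptimal f T
    IsDeleteOutput⇒LocallyOptimal {S = S} (order , _ , covers , refl) w∈T =
      deleteWith-locallyOptimal order S (proj₂ (covers _) (deleteWith-⊆ order S w∈T)) w∈T

    LocallyOptimal⇒f-⊆-≤ : LocallyOptimal f S → T ⊆ S → f T ≤ f S
    LocallyOptimal⇒f-⊆-≤ {S = S} {T = T} = go S (⊂-wellFounded S)
      where
      go : ∀ S → Acc _⊂_ S → LocallyOptimal f S → T ⊆ S → f T ≤ f S
      go S (acc smaller) opt T⊆S with nonempty? (S ─ T)
      ... | no  S─T-empty = ≤-reflexive (cong f (⊆-antisym T⊆S (Empty[p─q]⇒p⊆q S─T-empty)))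
      ... | yes (x , x∈S─T) = ≤-trans
        (go (S -ₑ x) (smaller (x∈p⇒p-x⊂p x∈S)) (LocallyOptimal-⊆ (p─q⊆p S ⁅ x ⁆) opt) T⊆S-x)
        (LocallyOptimal⇒f[p-x]≤f[p] opt x∈S)
        where
        x∈S : x ∈ S
        x∈S = p─q⊆p S T x∈S─T
        T⊆S-x : T ⊆ S -ₑ x
        T⊆S-x y∈T = x∈p∧x≢y⇒x∈p-y (T⊆S y∈T) λ { refl → x∈p─q⇒x∉q S T x∈S─T y∈T }

    IsGreedyRun⇒LocallyOptimal : ∀ {k Ss} → IsGreedyRun f k Ss → ∀ j → j ℕ.< k → LocallyOptimal f (Ss j)
    IsGreedyRun⇒LocallyOptimal (Ss0≡⊥ , _) ℕ.zero _ =
      subst (LocallyOptimal f) (sym Ss0≡⊥) (λ w∈⊥ → contradiction w∈⊥ ∉⊥)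
    IsGreedyRun⇒LocallyOptimal (_ , step) (suc j) 1+j<k =
      IsDeleteOutput⇒LocallyOptimal (proj₂ (proj₂ (step j (ℕ.<⇒≤ 1+j<k))))

    module _ {S : Subset n} {δ : ℚ} (marg≤δ : ∀ v → marg f v S ≤ δ) (δ≥0 : 0ℚ ≤ δ) where

      marg-⊇-≤ : S ⊆ A → marg f x A ≤ δ
      marg-⊇-≤ {A = A} {x = x} S⊆A with x ∈? A
      ... | yes x∈A = subst (_≤ δ) (sym (marg-∈ x∈A)) δ≥0
      ... | no  x∉A = ≤-trans (marg-antitone S⊆A x∉A) (marg≤δ x)

      f[p∪q]≤f[p]+δ*j : ∀ j {O} → ∣ O ∣ ≤ℕ j → f (S ∪ O) ≤ f S + δ * fromℕ j
      f[p∪q]≤f[p]+δ*j j {O} _ with nonempty? O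
      ... | no O-empty = begin
        f (S ∪ O)          ≡⟨ cong (λ O → f (S ∪ O)) (Empty-unique O-empty) ⟩
        f (S ∪ ⊥)          ≡⟨ cong f (∪-identityʳ S) ⟩
        f S                ≤⟨ p≤p+q δ*j≥0 ⟩
        f S + δ * fromℕ j  ∎
        where
        open ≤-Reasoning
        δ*j≥0 : 0ℚ ≤ δ * fromℕ j
        δ*j≥0 = subst (_≤ δ * fromℕ j) (*-zeroˡ (fromℕ j)) (*-monoʳ-≤-nonNeg (fromℕ j) δ≥0)
      f[p∪q]≤f[p]+δ*j (suc j) {O} |O|≤1+j | yes (x , x∈O) = begin
        f (S ∪ O)                           ≡⟨ cong f S∪O≡S∪[O-x]+x ⟩
        f ((S ∪ (O -ₑ x)) +ₑ x)             ≤⟨ p-q≤r⇒p≤q+r (marg-⊇-≤ (p⊆p∪q (O -ₑ x))) ⟩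
        f (S ∪ (O -ₑ x)) + δ                ≤⟨ +-monoˡ-≤ δ (f[p∪q]≤f[p]+δ*j j |O-x|≤j) ⟩
        f S + δ * fromℕ j + δ               ≡⟨ +-assoc (f S) (δ * fromℕ j) δ ⟩
        f S + (δ * fromℕ j + δ)             ≡⟨ cong (_+_ (f S)) (sym (*-fromℕ-suc δ j)) ⟩
        f S + δ * fromℕ (suc j)             ∎
        where
        open ≤-Reasoning
        S∪O≡S∪[O-x]+x : S ∪ O ≡ (S ∪ (O -ₑ x)) +ₑ x
        S∪O≡S∪[O-x]+x = trans (cong (S ∪_) (sym (x∈p⇒p-x+x≡p x∈O))) (sym (∪-assoc S (O -ₑ x) ⁅ x ⁆))
        |O-x|≤j : ∣ O -ₑ x ∣ ≤ℕ j
        |O-x|≤j = ℕ.≤-pred (ℕ.<-≤-trans (x∈p⇒∣p-x∣<∣p∣ x∈O) |O|≤1+j)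
      f[p∪q]≤f[p]+δ*j ℕ.zero {O} |O|≤0 | yes (x , x∈O) =
        contradiction (ℕ.<-≤-trans (x∈p⇒∣p-x∣<∣p∣ x∈O) |O|≤0) λ ()

    module _ (symmetric : Symmetric f) where

      f[⊥]≤f : ∀ X → f ⊥ ≤ f X
      f[⊥]≤f X = p+p≤q+q⇒p≤q (begin
        f ⊥ + f ⊥                    ≡⟨ cong₂ _+_ f⊥≡f[X∪∁X] (cong f (sym (∩-inverseʳ X))) ⟩
        f (X ∪ ∁ X) + f (X ∩ ∁ X)    ≤⟨ submodular X (∁ X) ⟩
        f X + f (∁ X)                ≡⟨ cong (_+_ (f X)) (sym (symmetric X)) ⟩
        f X + f X                    ∎)
        where
        open ≤-Reasoning
        f⊥≡f[X∪∁X] : f ⊥ ≡ f (X ∪ ∁ X)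
        f⊥≡f[X∪∁X] = trans (cong f (sym ∁⊤≡⊥)) (trans (sym (symmetric ⊤)) (cong f (sym (p∪∁p≡⊤ X))))

      IsArgmaxMarg⇒0≤marg : IsArgmaxMarg f S x → 0ℚ ≤ marg f x S
      IsArgmaxMarg⇒0≤marg {S = S} {x = x} argmax with nonempty? S
      ... | yes (y , y∈S) = subst (_≤ marg f x S) (marg-∈ y∈S) (argmax y)
      ... | no  S-empty   = subst (λ S → 0ℚ ≤ marg f x S) (sym (Empty-unique S-empty))
                                  (p≤q⇒0≤q-p (f[⊥]≤f (⊥ +ₑ x)))

      f[q]≤f[p∪q]+f[p─q] : NonNegative f → ∀ S O → f O ≤ f (S ∪ O) + f (S ─ O)
      f[q]≤f[p∪q]+f[p─q] nonNegative S O = begin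
        f O                                                ≤⟨ p≤q+p (nonNegative _) ⟩
        f ((S ∪ O) ∪ ∁ (S ─ O)) + f O                      ≡⟨ cong (λ X → f ((S ∪ O) ∪ ∁ (S ─ O)) + f X) (sym ([p∪q]∩∁[p─q]≡q S O)) ⟩
        f ((S ∪ O) ∪ ∁ (S ─ O)) + f ((S ∪ O) ∩ ∁ (S ─ O))  ≤⟨ submodular (S ∪ O) (∁ (S ─ O)) ⟩
        f (S ∪ O) + f (∁ (S ─ O))                          ≡⟨ cong (_+_ (f (S ∪ O))) (sym (symmetric (S ─ O))) ⟩
        f (S ∪ O) + f (S ─ O)                              ∎
        where open ≤-Reasoning

lemma3 : ∀ {n} (f : Subset n → ℚ) → NonNegative f → Symmetric f → Submodular f →
    (k : ℕ) .{{_ : NonZero k}} → (O : Subset n) → IsOptimal f k O →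
    (Ss : ℕ → Subset n) → IsGreedyRun f k Ss →
    ∀ i → 1 ≤ℕ i → i ≤ℕ k →
      (f O - (f (Ss (i ∸ 1)) + f (Ss (i ∸ 1)))) * ((+ 1) / k)
        ≤ f (Ss i) - f (Ss (i ∸ 1))
lemma3 f nonNegative symmetric submodular k O (|O|≤k , _) Ss run (suc j) _ j<k
  with proj₂ run j j<k
... | u , u-argmax , Sⱼ+u↦Sⱼ₊₁ =
  ≤-trans (p≤q*k⇒p*[1/k]≤q k (p≤q+r⇒p-q≤r f[O]≤2f[Sⱼ]+δk))
          (+-monoˡ-≤ (- f Sⱼ) (f≤f-IsDeleteOutput f Sⱼ+u↦Sⱼ₊₁))
  where
  Sⱼ : Subset _
  Sⱼ = Ss j
  δ : ℚ
  δ = marg f u Sⱼ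
  f[Sⱼ∪O]≤f[Sⱼ]+δk : f (Sⱼ ∪ O) ≤ f Sⱼ + δ * fromℕ k
  f[Sⱼ∪O]≤f[Sⱼ]+δk = f[p∪q]≤f[p]+δ*j f submodular u-argmax
    (IsArgmaxMarg⇒0≤marg f submodular symmetric u-argmax) k |O|≤k
  f[Sⱼ─O]≤f[Sⱼ] : f (Sⱼ ─ O) ≤ f Sⱼ
  f[Sⱼ─O]≤f[Sⱼ] = LocallyOptimal⇒f-⊆-≤ f submodular
    (IsGreedyRun⇒LocallyOptimal f submodular run j j<k) (p─q⊆p Sⱼ O)
  f[O]≤2f[Sⱼ]+δk : f O ≤ (f Sⱼ + f Sⱼ) + δ * fromℕ k
  f[O]≤2f[Sⱼ]+δk = begin
    f O                          ≤⟨ f[q]≤f[p∪q]+f[p─q] f submodular symmetric nonNegative Sⱼ O ⟩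
    f (Sⱼ ∪ O) + f (Sⱼ ─ O)      ≤⟨ +-mono-≤ f[Sⱼ∪O]≤f[Sⱼ]+δk f[Sⱼ─O]≤f[Sⱼ] ⟩
    (f Sⱼ + δ * fromℕ k) + f Sⱼ  ≡⟨ solve 2 (λ a b → (a :+ b) :+ a := (a :+ a) :+ b) refl (f Sⱼ) (δ * fromℕ k) ⟩
    (f Sⱼ + f Sⱼ) + δ * fromℕ k  ∎
    where
    open ≤-Reasoning
    open +-*-Solver
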